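{- Let $C$ be a field, $E$ a vector space over $C$ with a valuation $v:E\to\Gamma_\infty$, and let $(f,\gamma)\mapsto f|_\gamma:E\times\Gamma\to E$ satisfy (t1)–(t4) below. Let $P=\{f\in E:\operatorname{sp}(f)\text{ is a singleton}\}$. Then: (i) if $\operatorname{sp}(f)=\{\gamma_1,\dots,\gamma_n\}$ with $\gamma_1<\dots<\gamma_n$, then there are $f_1,\dots,f_n\in P$ with $vf_i=\gamma_i$ for $i=1,\dots,n$ and $f=f_1+\dots+f_n$; (ii) $\operatorname{sp}(f)$ is finite iff $f\in\sum P:=\{f_1+\dots+f_n: n\ge0,\ f_1,\dots,f_n\in P\}$; (iii) if $f,g\in P\cup\{0\}$ and $vf=vg$, then $f+g\in P\cup\{0\}$; (iv) if $E$ is a Hahn space and $f,g\in P$ with $vf=vg$, then $f=cg$ for some $c\in C^\times$.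
   Context: $\Gamma$ is a linearly ordered set, $\Gamma_\infty=\Gamma\cup\{\infty\}$ with $\gamma<\infty$ for all $\gamma\in\Gamma$. A valuation on the $C$-vector space $E$ is a surjective map $v:E\to\Gamma_\infty$ with $v(f)=\infty\iff f=0$, $v(cf)=v(f)$ for $c\in C^\times$, and $v(f+g)\ge\min(vf,vg)$. Write $f\sim g$ iff $v(f-g)>v(f)$. $E$ is a Hahn space if for all nonzero $f,g$ with $vf=vg$ there is $c\in C^\times$ with $f\sim cg$. The truncation map satisfies, for all $f,g\in E$, $c\in C$, $\alpha,\beta\in\Gamma$: (t1) $v(f-f|_\alpha)\ge\alpha$; (t2) $v(f)\ge\alpha\Rightarrow f|_\alpha=0$; (t3) $\beta>\alpha\Rightarrow(f|_\alpha)|_\beta=f|_\alpha$; (t4) $(f+g)|_\alpha=f|_\alpha+g|_\alpha$ and $(cf)|_\alpha=c(f|_\alpha)$. Set $\operatorname{sp}(f)=\{\gamma\in\Gamma: v(f-f|_\gamma)=\gamma\}$. -}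

module Defs where

open import Level using (0ℓ)
open import Data.Nat using (ℕ; zero; suc)
open import Data.Fin using (Fin; zero; suc)
open import Data.Product using (Σ; ∃; _×_; _,_)
open import Data.Sum using (_⊎_)
open import Relation.Nullary using (¬_)
open import Relation.Binary using (Rel)
open import Relation.Binary.PropositionalEquality using (_≡_)
open import Algebra.Bundles using (CommutativeRing)
open import Algebra.Module.Bundles using (Module)
open import Function.Bundles using (_⇔_)

record IsField (R : CommutativeRing 0ℓ 0ℓ) : Set where
  open CommutativeRing R
  field
    1≉0     : ¬ (1# ≈ 0#)
    inverse : ∀ x → ¬ (x ≈ 0#) → ∃ λ y → x * y ≈ 1#

data Γ∞ (Γ : Set) : Set where
  fin : Γ → Γ∞ Γ
  ∞   : Γ∞ Γ

module Valued (R : CommutativeRing 0ℓ 0ℓ) (M : Module R 0ℓ 0ℓ)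
              (Γ : Set) (_<_ : Rel Γ 0ℓ) where
  open CommutativeRing R using (_≈_; 0#) renaming (Carrier to C)
  open Module M

  data _<∞_ : Γ∞ Γ → Γ∞ Γ → Set where
    fin<fin : ∀ {α β} → α < β → fin α <∞ fin β
    fin<∞   : ∀ {α} → fin α <∞ ∞

  _≤∞_ : Γ∞ Γ → Γ∞ Γ → Set
  a ≤∞ b = a <∞ b ⊎ a ≡ b

  min∞ : Γ∞ Γ → Γ∞ Γ → Γ∞ Γ → Set
  -- "c ≥ min(a,b)"
  min∞ a b c = a ≤∞ c ⊎ b ≤∞ c

  _-ᴹ_ : Carrierᴹ → Carrierᴹ → Carrierᴹ
  f -ᴹ g = f +ᴹ (-ᴹ g)

  sumᴹ : ∀ n → (Fin n → Carrierᴹ) → Carrierᴹ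
  sumᴹ zero    fs = 0ᴹ
  sumᴹ (suc n) fs = fs zero +ᴹ sumᴹ n (λ i → fs (suc i))

  record IsValuation (v : Carrierᴹ → Γ∞ Γ) : Set where
    field
      v-cong     : ∀ {f g} → f ≈ᴹ g → v f ≡ v g
      surjective : ∀ (a : Γ∞ Γ) → ∃ λ f → v f ≡ a
      v-∞        : ∀ f → (v f ≡ ∞ ⇔ f ≈ᴹ 0ᴹ)
      v-scale    : ∀ (c : C) f → ¬ (c ≈ 0#) → v (c *ₗ f) ≡ v f
      v-ultra    : ∀ f g → min∞ (v f) (v g) (v (f +ᴹ g))

  module _ (v : Carrierᴹ → Γ∞ Γ) where

    _∼_ : Carrierᴹ → Carrierᴹ → Set
    f ∼ g = v f <∞ v (f -ᴹ g)

    IsHahn : Set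
    IsHahn = ∀ f g → ¬ (f ≈ᴹ 0ᴹ) → ¬ (g ≈ᴹ 0ᴹ) → v f ≡ v g →
             ∃ λ (c : C) → ¬ (c ≈ 0#) × (f ∼ (c *ₗ g))

    record IsTruncation (tr : Carrierᴹ → Γ → Carrierᴹ) : Set where
      field
        tr-cong : ∀ {f g} α → f ≈ᴹ g → tr f α ≈ᴹ tr g α
        t1 : ∀ f α → fin α ≤∞ v (f -ᴹ tr f α)
        t2 : ∀ f α → fin α ≤∞ v f → tr f α ≈ᴹ 0ᴹ
        t3 : ∀ f α β → α < β → tr (tr f α) β ≈ᴹ tr f α
        t4+ : ∀ f g α → tr (f +ᴹ g) α ≈ᴹ (tr f α +ᴹ tr g α)
        t4* : ∀ (c : C) f α → tr (c *ₗ f) α ≈ᴹ (c *ₗ tr f α)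

    module _ (tr : Carrierᴹ → Γ → Carrierᴹ) where

      sp : Carrierᴹ → Γ → Set
      sp f γ = v (f -ᴹ tr f γ) ≡ fin γ

      IsSingleton : (Γ → Set) → Set
      IsSingleton S = ∃ λ γ → ∀ δ → (S δ ⇔ δ ≡ γ)

      IsFinite : (Γ → Set) → Set
      IsFinite S = ∃ λ n → Σ (Fin n → Γ) λ e → ∀ δ → (S δ ⇔ ∃ λ i → e i ≡ δ)

      P : Carrierᴹ → Set
      P f = IsSingleton (sp f)

      P∪0 : Carrierᴹ → Set
      P∪0 f = P f ⊎ f ≈ᴹ 0ᴹ

      InSumP : Carrierᴹ → Set
      InSumP f = ∃ λ n → Σ (Fin n → Carrierᴹ) λ fs → (∀ i → P (fs i)) × f ≈ᴹ sumᴹ n fs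

      StrictlyIncreasing : ∀ {n} → (Fin n → Γ) → Set
      StrictlyIncreasing {n} γs = ∀ (i j : Fin n) → Data.Fin._<_ i j → γs i < γs j

      Conclusion : Set
      Conclusion =
        (∀ f n (γs : Fin n → Γ) → StrictlyIncreasing γs →
           (∀ δ → (sp f δ ⇔ ∃ λ i → γs i ≡ δ)) →
           Σ (Fin n → Carrierᴹ) λ fs →
             (∀ i → P (fs i)) × (∀ i → v (fs i) ≡ fin (γs i)) × f ≈ᴹ sumᴹ n fs)
        ×
        (∀ f → (IsFinite (sp f) ⇔ InSumP f))
        ×
        (∀ f g → P∪0 f → P∪0 g → v f ≡ v g → P∪0 (f +ᴹ g))
        ×
        (IsHahn → ∀ f g → P f → P g → v f ≡ v g →
           ∃ λ (c : C) → ¬ (c ≈ 0#) × f ≈ᴹ (c *ₗ g))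

{-# OPTIONS --safe #-}
-- Truncation splits the support: sp (f|γ) = sp f ∩ (< γ) and sp (f - f|γ) = sp f ∩ (≥ γ).
-- Both come from applying (t4) to f = f|γ + (f - f|γ).  For α < γ the second summand only
-- perturbs f - f|α by an element of valuation > α, which by the ultrametric inequality cannot
-- change whether v (f - f|α) = α; for α ≥ γ the first summand contributes nothing, as
-- (f|γ)|α = f|γ.  Splitting f at the second element of sp f gives (i) by induction, splitting
-- at its largest element gives (ii).  Together with sp (f + g) ⊆ sp f ∪ sp g this gives (iii),
-- and, applied to f - c g, (iv): the Hahn property makes v (f - c g) > v f, whereas a nonzero
-- element with support in {v f} has valuation v f.
module Submission where

open import Defs
open import Level using (0ℓ)
open import Relation.Binary using (Rel; IsStrictTotalOrder)
open import Relation.Binary.PropositionalEquality using (_≡_)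
open import Algebra.Bundles using (CommutativeRing)
open import Algebra.Module.Bundles using (Module)
open import Axiom.ExcludedMiddle using (ExcludedMiddle)

open import Algebra.Bundles using (CommutativeMonoid)
open import Data.Empty using (⊥-elim)
open import Data.Fin using (Fin; zero; suc; punchIn; punchOut)
import Data.Fin as Fin
open import Data.Fin.Properties using (¬Fin0; punchIn-punchOut; <-cmp)
open import Data.List using (List; filter; tabulate; lookup; length)
open import Data.List.Membership.Propositional using (_∈_)
open import Data.List.Membership.Propositional.Properties using (∈-lookup; ∈-filter⁺; ∈-filter⁻; ∈-tabulate⁺)
open import Data.List.Relation.Unary.Any using (index)
open import Data.List.Relation.Unary.Any.Properties using (lookup-index)
open import Data.Nat using (ℕ; z≤n; s≤s)
open import Data.Product using (Σ; ∃; _×_; _,_; proj₁; proj₂)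
open import Data.Sum using (_⊎_; inj₁; inj₂; [_,_]′)
open import Data.Vec.Functional using (_∷_)
open import Function.Base using (_∘_; case_of_)
open import Function.Bundles using (_⇔_; mk⇔; Equivalence)
open import Function.Properties.Equivalence using () renaming (trans to ⇔-trans)
open import Relation.Binary.Definitions using (tri<; tri≈; tri>)
open import Relation.Binary.PropositionalEquality using (_≢_; refl; sym; trans; subst; subst₂; cong)
open import Relation.Nullary using (¬_; yes; no)
open import Relation.Unary using (Pred; Decidable; _⊆_; ｛_｝)
import Algebra.Properties.AbelianGroup as AbelianGroupProperties
import Algebra.Properties.CommutativeSemigroup as CommutativeSemigroupProperties
import Algebra.Properties.Ring as RingProperties
import Relation.Binary.Reasoning.Setoid as SetoidReasoning

open Equivalence using (to; from)

Image : {A : Set} {n : ℕ} → (Fin n → A) → Pred A 0ℓ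
Image e x = ∃ λ i → e i ≡ x

Enumerable : {A : Set} → Pred A 0ℓ → Set
Enumerable {A} S = ∃ λ n → Σ (Fin n → A) λ e → ∀ x → S x ⇔ Image e x

∈⇔Image-lookup : {A : Set} (xs : List A) {x : A} → x ∈ xs ⇔ Image (lookup xs) x
∈⇔Image-lookup xs = mk⇔ (λ x∈xs → index x∈xs , sym (lookup-index x∈xs))
                        (λ { (i , refl) → ∈-lookup i })

decidable⊆Image⇒Enumerable : {A : Set} {S : Pred A 0ℓ} → Decidable S →
  ∀ {n} (e : Fin n → A) → S ⊆ Image e → Enumerable S
decidable⊆Image⇒Enumerable {S = S} S? e S⊆e = length xs , lookup xs , λ x →
  mk⇔ (λ s → to (∈⇔Image-lookup xs) (∈-filter⁺ S? {xs = tabulate e} (∈-tabulate s) s))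
      (λ j → proj₂ (∈-filter⁻ S? {xs = tabulate e} (from (∈⇔Image-lookup xs) j)))
  where
  xs = filter S? (tabulate e)
  ∈-tabulate : ∀ {x} → S x → x ∈ tabulate e
  ∈-tabulate s with S⊆e s
  ... | i , refl = ∈-tabulate⁺ i

module _ {A : Set} {_<_ : Rel A 0ℓ} (<-sto : IsStrictTotalOrder _≡_ _<_) where
  open IsStrictTotalOrder <-sto using (compare; irrefl) renaming (trans to <-trans)

  max-index : ∀ {n} (e : Fin (ℕ.suc n) → A) → ∃ λ k → ∀ i → ¬ (e k < e i)
  max-index {ℕ.zero} e = zero , λ { zero → irrefl refl }
  max-index {ℕ.suc n} e with max-index (λ i → e (suc i))
  ... | k , k-max with compare (e zero) (e (suc k))
  ... | tri< _ _ ¬ek<e0 = suc k , λ { zero → ¬ek<e0 ; (suc i) → k-max i }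
  ... | tri≈ _ _ ¬ek<e0 = suc k , λ { zero → ¬ek<e0 ; (suc i) → k-max i }
  ... | tri> _ _ ek<e0  = zero , λ { zero → irrefl refl ; (suc i) e0<ei → k-max i (<-trans ek<e0 e0<ei) }

module Valuations
  (R : CommutativeRing 0ℓ 0ℓ) (M : Module R 0ℓ 0ℓ)
  {Γ : Set} {_<_ : Rel Γ 0ℓ} (<-sto : IsStrictTotalOrder _≡_ _<_) where

  open CommutativeRing R using (_≈_; 0#; 1#; _+_; -_; -‿cong; -‿inverseʳ) renaming (sym to ≈-sym; trans to ≈-trans)
  open Module M
  open AbelianGroupProperties +ᴹ-abelianGroup
    using (ε⁻¹≈ε; ⁻¹-∙-comm; inverseʳ-unique; x∙y⁻¹≈ε⇒x≈y; x≈y⇒x∙y⁻¹≈ε; //-rightDividesˡ; //-rightDividesʳ)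
  open CommutativeSemigroupProperties (CommutativeMonoid.commutativeSemigroup +ᴹ-commutativeMonoid)
    using (interchange)
  open RingProperties (CommutativeRing.ring R) using (-‿involutive; -0#≈0#)
  open IsStrictTotalOrder <-sto using (compare; irrefl; asym) renaming (trans to <-trans)
  open SetoidReasoning ≈ᴹ-setoid
  module V = Valued R M Γ _<_
  open V using (_<∞_; fin<fin; fin<∞; _≤∞_; min∞; _-ᴹ_; sumᴹ; IsValuation; IsTruncation)

  fin-injective : ∀ {α β : Γ} → fin α ≡ fin β → α ≡ β
  fin-injective refl = refl

  <∞-irrefl : ∀ {a} → ¬ (a <∞ a)
  <∞-irrefl (fin<fin α<α) = irrefl refl α<α

  <∞-trans : ∀ {a b c} → a <∞ b → b <∞ c → a <∞ c
  <∞-trans (fin<fin α<β) (fin<fin β<γ) = fin<fin (<-trans α<β β<γ)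
  <∞-trans (fin<fin _)   fin<∞         = fin<∞
  <∞-trans fin<∞         ()

  <∞-≤∞-trans : ∀ {a b c} → a <∞ b → b ≤∞ c → a <∞ c
  <∞-≤∞-trans a<b (inj₁ b<c) = <∞-trans a<b b<c
  <∞-≤∞-trans a<b (inj₂ refl) = a<b

  ≡⇒≡fin⇔ : ∀ {a b : Γ∞ Γ} {α} → a ≡ b → a ≡ fin α ⇔ b ≡ fin α
  ≡⇒≡fin⇔ a≡b = mk⇔ (trans (sym a≡b)) (trans a≡b)

  *ₗ-‿-ᴹ : ∀ c x → c *ₗ (-ᴹ x) ≈ᴹ -ᴹ (c *ₗ x)
  *ₗ-‿-ᴹ c x = inverseʳ-unique (c *ₗ x) (c *ₗ (-ᴹ x)) (begin
    c *ₗ x +ᴹ c *ₗ (-ᴹ x) ≈⟨ *ₗ-distribˡ c x (-ᴹ x) ⟨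
    c *ₗ (x -ᴹ x)         ≈⟨ *ₗ-congˡ (-ᴹ‿inverseʳ x) ⟩
    c *ₗ 0ᴹ               ≈⟨ *ₗ-zeroʳ c ⟩
    0ᴹ                    ∎)

  -1*ₗ≈-ᴹ : ∀ x → (- 1#) *ₗ x ≈ᴹ -ᴹ x
  -1*ₗ≈-ᴹ x = inverseʳ-unique x ((- 1#) *ₗ x) (begin
    x +ᴹ (- 1#) *ₗ x        ≈⟨ +ᴹ-congʳ (*ₗ-identityˡ x) ⟨
    1# *ₗ x +ᴹ (- 1#) *ₗ x  ≈⟨ *ₗ-distribʳ x 1# (- 1#) ⟨
    (1# + - 1#) *ₗ x        ≈⟨ *ₗ-congʳ (-‿inverseʳ 1#) ⟩
    0# *ₗ x                 ≈⟨ *ₗ-zeroˡ x ⟩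
    0ᴹ                      ∎)

  module Valuation (1≉0 : ¬ (1# ≈ 0#)) {v : Carrierᴹ → Γ∞ Γ} (valuation : IsValuation v) where
    open IsValuation valuation

    -1≉0 : ¬ (- 1# ≈ 0#)
    -1≉0 -1≈0 = 1≉0 (≈-trans (≈-sym (-‿involutive 1#)) (≈-trans (-‿cong -1≈0) -0#≈0#))

    v-neg : ∀ x → v (-ᴹ x) ≡ v x
    v-neg x = trans (v-cong (≈ᴹ-sym (-1*ₗ≈-ᴹ x))) (v-scale (- 1#) x -1≉0)

    v-0 : v 0ᴹ ≡ ∞
    v-0 = from (v-∞ 0ᴹ) ≈ᴹ-refl

    v-fin-or-≈0 : ∀ f → (∃ λ δ → v f ≡ fin δ) ⊎ f ≈ᴹ 0ᴹ
    v-fin-or-≈0 f = by-value (v f) refl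
      where
      by-value : ∀ a → v f ≡ a → (∃ λ δ → v f ≡ fin δ) ⊎ f ≈ᴹ 0ᴹ
      by-value (fin δ) vf≡δ = inj₁ (δ , vf≡δ)
      by-value ∞       vf≡∞ = inj₂ (to (v-∞ f) vf≡∞)

    <∞-v-+ : ∀ {a} f g → a <∞ v f → a <∞ v g → a <∞ v (f +ᴹ g)
    <∞-v-+ f g a<vf a<vg with v-ultra f g
    ... | inj₁ vf≤ = <∞-≤∞-trans a<vf vf≤
    ... | inj₂ vg≤ = <∞-≤∞-trans a<vg vg≤

    v-+-≡ˡ : ∀ x y → v x <∞ v y → v (x +ᴹ y) ≡ v x
    v-+-≡ˡ x y vx<vy = from-ultra (v-ultra x y)
      where
      -- x = (x + y) - y, so v x ≥ min (v (x + y), v y) > v x otherwise.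
      no-gain : ¬ (v x <∞ v (x +ᴹ y))
      no-gain vx< = <∞-irrefl (subst (v x <∞_) (v-cong (//-rightDividesʳ y x))
        (<∞-v-+ (x +ᴹ y) (-ᴹ y) vx< (subst (v x <∞_) (sym (v-neg y)) vx<vy)))
      from-ultra : min∞ (v x) (v y) (v (x +ᴹ y)) → v (x +ᴹ y) ≡ v x
      from-ultra (inj₁ (inj₂ vx≡)) = sym vx≡
      from-ultra (inj₁ (inj₁ vx<)) = ⊥-elim (no-gain vx<)
      from-ultra (inj₂ vy≤)        = ⊥-elim (no-gain (<∞-≤∞-trans vx<vy vy≤))

    v-+-perturb : ∀ {α} x y → fin α <∞ v y → v (x +ᴹ y) ≡ fin α ⇔ v x ≡ fin α
    v-+-perturb {α} x y α<vy = mk⇔ unperturb perturb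
      where
      perturb : v x ≡ fin α → v (x +ᴹ y) ≡ fin α
      perturb vx≡α = trans (v-+-≡ˡ x y (subst (_<∞ v y) (sym vx≡α) α<vy)) vx≡α
      unperturb : v (x +ᴹ y) ≡ fin α → v x ≡ fin α
      unperturb vx+y≡α = trans (v-cong (≈ᴹ-sym (//-rightDividesʳ y x)))
        (trans (v-+-≡ˡ (x +ᴹ y) (-ᴹ y) (subst₂ _<∞_ (sym vx+y≡α) (sym (v-neg y)) α<vy)) vx+y≡α)

    module Truncation {tr : Carrierᴹ → Γ → Carrierᴹ} (truncation : IsTruncation v tr) where
      open IsTruncation truncation

      sp : Carrierᴹ → Pred Γ 0ℓ
      sp = V.sp v tr

      P : Pred Carrierᴹ 0ℓ
      P = V.P v tr

      P∪0 : Pred Carrierᴹ 0ℓ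
      P∪0 = V.P∪0 v tr

      InSumP : Pred Carrierᴹ 0ℓ
      InSumP = V.InSumP v tr

      tail : Carrierᴹ → Γ → Carrierᴹ
      tail f α = f -ᴹ tr f α

      tr+tail : ∀ f α → tr f α +ᴹ tail f α ≈ᴹ f
      tr+tail f α = ≈ᴹ-trans (+ᴹ-comm (tr f α) (tail f α)) (//-rightDividesˡ (tr f α) f)

      tail-cong : ∀ {f g} α → f ≈ᴹ g → tail f α ≈ᴹ tail g α
      tail-cong α f≈g = +ᴹ-cong f≈g (-ᴹ‿cong (tr-cong α f≈g))

      tail-+ : ∀ f g α → tail (f +ᴹ g) α ≈ᴹ tail f α +ᴹ tail g α
      tail-+ f g α = begin
        (f +ᴹ g) -ᴹ tr (f +ᴹ g) α                ≈⟨ +ᴹ-congˡ (-ᴹ‿cong (t4+ f g α)) ⟩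
        (f +ᴹ g) -ᴹ (tr f α +ᴹ tr g α)           ≈⟨ +ᴹ-congˡ (⁻¹-∙-comm (tr f α) (tr g α)) ⟨
        (f +ᴹ g) +ᴹ (-ᴹ tr f α +ᴹ -ᴹ tr g α)     ≈⟨ interchange f g (-ᴹ tr f α) (-ᴹ tr g α) ⟩
        tail f α +ᴹ tail g α                     ∎

      tail-*ₗ : ∀ c f α → tail (c *ₗ f) α ≈ᴹ c *ₗ tail f α
      tail-*ₗ c f α = begin
        (c *ₗ f) -ᴹ tr (c *ₗ f) α      ≈⟨ +ᴹ-congˡ (-ᴹ‿cong (t4* c f α)) ⟩
        (c *ₗ f) -ᴹ (c *ₗ tr f α)      ≈⟨ +ᴹ-congˡ (*ₗ-‿-ᴹ c (tr f α)) ⟨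
        c *ₗ f +ᴹ c *ₗ (-ᴹ tr f α)     ≈⟨ *ₗ-distribˡ c f (-ᴹ tr f α) ⟨
        c *ₗ tail f α                  ∎

      tail-≈ : ∀ f α → fin α ≤∞ v f → tail f α ≈ᴹ f
      tail-≈ f α α≤vf = begin
        f -ᴹ tr f α  ≈⟨ +ᴹ-congˡ (-ᴹ‿cong (t2 f α α≤vf)) ⟩
        f -ᴹ 0ᴹ      ≈⟨ +ᴹ-congˡ ε⁻¹≈ε ⟩
        f +ᴹ 0ᴹ      ≈⟨ +ᴹ-identityʳ f ⟩
        f            ∎

      tr-idem : ∀ f α → tr (tr f α) α ≈ᴹ tr f α
      tr-idem f α = begin
        tr (tr f α) α                     ≈⟨ +ᴹ-identityʳ _ ⟨
        tr (tr f α) α +ᴹ 0ᴹ               ≈⟨ +ᴹ-congˡ (t2 (tail f α) α (t1 f α)) ⟨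
        tr (tr f α) α +ᴹ tr (tail f α) α  ≈⟨ t4+ (tr f α) (tail f α) α ⟨
        tr (tr f α +ᴹ tail f α) α         ≈⟨ tr-cong α (tr+tail f α) ⟩
        tr f α                            ∎

      tail-split : ∀ f γ α → tail f α ≈ᴹ tail (tr f γ) α +ᴹ tail (tail f γ) α
      tail-split f γ α = ≈ᴹ-trans (tail-cong α (≈ᴹ-sym (tr+tail f γ))) (tail-+ (tr f γ) (tail f γ) α)

      sp-cong : ∀ {f g α} → f ≈ᴹ g → sp f α ⇔ sp g α
      sp-cong {α = α} f≈g = ≡⇒≡fin⇔ (v-cong (tail-cong α f≈g))

      sp-*ₗ : ∀ {c f α} → ¬ (c ≈ 0#) → sp (c *ₗ f) α ⇔ sp f α
      sp-*ₗ {c} {f} {α} c≉0 = ≡⇒≡fin⇔ (trans (v-cong (tail-*ₗ c f α)) (v-scale c (tail f α) c≉0))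

      sp-neg : ∀ {f α} → sp (-ᴹ f) α ⇔ sp f α
      sp-neg {f} = ⇔-trans (sp-cong (≈ᴹ-sym (-1*ₗ≈-ᴹ f))) (sp-*ₗ -1≉0)

      sp-or-above : ∀ f α → sp f α ⊎ fin α <∞ v (tail f α)
      sp-or-above f α with t1 f α
      ... | inj₁ α<v = inj₂ α<v
      ... | inj₂ α≡v = inj₁ (sym α≡v)

      ¬sp-above : ∀ {f α} → fin α <∞ v (tail f α) → ¬ sp f α
      ¬sp-above α<v s = <∞-irrefl (subst (fin _ <∞_) s α<v)

      ¬sp-tail≈0 : ∀ {f α} → tail f α ≈ᴹ 0ᴹ → ¬ sp f α
      ¬sp-tail≈0 {f} {α} tail≈0 s with trans (sym s) (from (v-∞ (tail f α)) tail≈0)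
      ... | ()

      sp? : ∀ f → Decidable (sp f)
      sp? f α with sp-or-above f α
      ... | inj₁ s    = yes s
      ... | inj₂ α<v  = no (¬sp-above α<v)

      v⇒sp : ∀ {f δ} → v f ≡ fin δ → sp f δ
      v⇒sp {f} {δ} vf≡δ = trans (v-cong (tail-≈ f δ (inj₂ (sym vf≡δ)))) vf≡δ

      ¬sp-≈0 : ∀ {f α} → f ≈ᴹ 0ᴹ → ¬ sp f α
      ¬sp-≈0 {α = α} f≈0 = ¬sp-tail≈0 (≈ᴹ-trans (tail-cong α f≈0)
        (tail-≈ 0ᴹ α (inj₁ (subst (fin α <∞_) (sym v-0) fin<∞))))

      sp-empty⇒≈0 : ∀ {f} → (∀ δ → ¬ sp f δ) → f ≈ᴹ 0ᴹ
      sp-empty⇒≈0 {f} sp-empty with v-fin-or-≈0 f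
      ... | inj₁ (δ , vf≡δ) = ⊥-elim (sp-empty δ (v⇒sp vf≡δ))
      ... | inj₂ f≈0        = f≈0

      sp-+ : ∀ f g → sp (f +ᴹ g) ⊆ λ α → sp f α ⊎ sp g α
      sp-+ f g {α} s with sp-or-above g α
      ... | inj₁ sg   = inj₂ sg
      ... | inj₂ α<vg =
        inj₁ (to (v-+-perturb (tail f α) (tail g α) α<vg) (trans (sym (v-cong (tail-+ f g α))) s))

      v-tail-tail-> : ∀ f {α γ} → α < γ → fin α <∞ v (tail (tail f γ) α)
      v-tail-tail-> f {α} {γ} α<γ =
        subst (fin α <∞_) (sym (v-cong (tail-≈ (tail f γ) α (inj₁ α<v-tail)))) α<v-tail
        where
        α<v-tail : fin α <∞ v (tail f γ)
        α<v-tail = <∞-≤∞-trans (fin<fin α<γ) (t1 f γ)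

      tail-tr-≥ : ∀ f {α γ} → γ < α ⊎ γ ≡ α → tail (tr f γ) α ≈ᴹ 0ᴹ
      tail-tr-≥ f {α} {γ} (inj₁ γ<α) = x≈y⇒x∙y⁻¹≈ε (≈ᴹ-sym (t3 f γ α γ<α))
      tail-tr-≥ f         (inj₂ refl) = x≈y⇒x∙y⁻¹≈ε (≈ᴹ-sym (tr-idem f _))

      sp-tr-< : ∀ f {α γ} → α < γ → sp f α ⇔ sp (tr f γ) α
      sp-tr-< f {α} {γ} α<γ = ⇔-trans (≡⇒≡fin⇔ (v-cong (tail-split f γ α)))
        (v-+-perturb (tail (tr f γ) α) (tail (tail f γ) α) (v-tail-tail-> f α<γ))

      ¬sp-tr-≥ : ∀ f {α γ} → γ < α ⊎ γ ≡ α → ¬ sp (tr f γ) α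
      ¬sp-tr-≥ f γ≤α = ¬sp-tail≈0 (tail-tr-≥ f γ≤α)

      ¬sp-tail-< : ∀ f {α γ} → α < γ → ¬ sp (tail f γ) α
      ¬sp-tail-< f α<γ = ¬sp-above (v-tail-tail-> f α<γ)

      sp-tail-≥ : ∀ f {α γ} → γ < α ⊎ γ ≡ α → sp f α ⇔ sp (tail f γ) α
      sp-tail-≥ f {α} {γ} γ≤α = ≡⇒≡fin⇔ (v-cong (begin
        tail f α                                 ≈⟨ tail-split f γ α ⟩
        tail (tr f γ) α +ᴹ tail (tail f γ) α     ≈⟨ +ᴹ-congʳ (tail-tr-≥ f γ≤α) ⟩
        0ᴹ +ᴹ tail (tail f γ) α                  ≈⟨ +ᴹ-identityˡ _ ⟩
        tail (tail f γ) α                        ∎))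

      sp-tr : ∀ f γ α → sp (tr f γ) α ⇔ (sp f α × α < γ)
      sp-tr f γ α with compare α γ
      ... | tri< α<γ _ _     = mk⇔ (λ s → from (sp-tr-< f α<γ) s , α<γ) (to (sp-tr-< f α<γ) ∘ proj₁)
      ... | tri≈ ¬α<γ refl _ = mk⇔ (⊥-elim ∘ ¬sp-tr-≥ f (inj₂ refl)) (⊥-elim ∘ ¬α<γ ∘ proj₂)
      ... | tri> ¬α<γ _ γ<α  = mk⇔ (⊥-elim ∘ ¬sp-tr-≥ f (inj₁ γ<α)) (⊥-elim ∘ ¬α<γ ∘ proj₂)

      sp-tail : ∀ f γ α → sp (tail f γ) α ⇔ (sp f α × ¬ α < γ)
      sp-tail f γ α with compare α γ
      ... | tri< α<γ _ _     = mk⇔ (⊥-elim ∘ ¬sp-tail-< f α<γ) (λ (_ , ¬α<γ) → ⊥-elim (¬α<γ α<γ))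
      ... | tri≈ ¬α<γ refl _ = mk⇔ (λ s → from (sp-tail-≥ f (inj₂ refl)) s , ¬α<γ) (to (sp-tail-≥ f (inj₂ refl)) ∘ proj₁)
      ... | tri> ¬α<γ _ γ<α  = mk⇔ (λ s → from (sp-tail-≥ f (inj₁ γ<α)) s , ¬α<γ) (to (sp-tail-≥ f (inj₁ γ<α)) ∘ proj₁)

      P⇒v : ∀ {f} (p : P f) → v f ≡ fin (proj₁ p)
      P⇒v {f} (γ , sp≐γ) with v-fin-or-≈0 f
      ... | inj₁ (δ , vf≡δ) = trans vf≡δ (cong fin (to (sp≐γ δ) (v⇒sp vf≡δ)))
      ... | inj₂ f≈0        = ⊥-elim (¬sp-≈0 f≈0 (from (sp≐γ γ) refl))

      P⇒≉0 : ∀ {f} → P f → ¬ (f ≈ᴹ 0ᴹ)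
      P⇒≉0 (γ , sp≐γ) f≈0 = ¬sp-≈0 f≈0 (from (sp≐γ γ) refl)

      P⇒sp⊆ : ∀ {f γ} → P f → v f ≡ fin γ → sp f ⊆ ｛ γ ｝
      P⇒sp⊆ p vf≡γ s = trans (fin-injective (trans (sym vf≡γ) (P⇒v p))) (sym (to (proj₂ p _) s))

      sp⊆｛｝⇒P∪0 : ∀ {f γ} → sp f ⊆ ｛ γ ｝ → P∪0 f
      sp⊆｛｝⇒P∪0 {f} {γ} sp⊆γ with v-fin-or-≈0 f
      ... | inj₂ f≈0        = inj₂ f≈0
      ... | inj₁ (δ , vf≡δ) = inj₁ (γ , λ α → mk⇔ (λ s → sym (sp⊆γ s)) λ { refl → sp-γ })
        where
        sp-γ : sp f γ
        sp-γ = subst (sp f) (sym (sp⊆γ (v⇒sp vf≡δ))) (v⇒sp vf≡δ)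

      P∪0-resp : ∀ {f g} → f ≈ᴹ g → P∪0 f → P∪0 g
      P∪0-resp f≈g (inj₁ (γ , sp≐γ)) = inj₁ (γ , λ α → ⇔-trans (sp-cong (≈ᴹ-sym f≈g)) (sp≐γ α))
      P∪0-resp f≈g (inj₂ f≈0)        = inj₂ (≈ᴹ-trans (≈ᴹ-sym f≈g) f≈0)

      InSumP-resp : ∀ {f g} → f ≈ᴹ g → InSumP f → InSumP g
      InSumP-resp f≈g (n , fs , Ps , f≈Σ) = n , fs , Ps , ≈ᴹ-trans (≈ᴹ-sym f≈g) f≈Σ

      P∪0-+-InSumP : ∀ {g h} → P∪0 g → InSumP h → InSumP (g +ᴹ h)
      P∪0-+-InSumP {g} (inj₁ Pg) (n , fs , Ps , h≈Σ) =
        ℕ.suc n , g ∷ fs , (λ { zero → Pg ; (suc i) → Ps i }) , +ᴹ-congˡ h≈Σ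
      P∪0-+-InSumP {g} {h} (inj₂ g≈0) h∈ΣP =
        InSumP-resp (≈ᴹ-sym (≈ᴹ-trans (+ᴹ-congʳ g≈0) (+ᴹ-identityˡ h))) h∈ΣP

      StrictlyIncreasing : ∀ {n} → (Fin n → Γ) → Set
      StrictlyIncreasing = V.StrictlyIncreasing v tr

      StrictlyIncreasing-reflects-< : ∀ {n} {γs : Fin n → Γ} → StrictlyIncreasing γs →
        ∀ {i j} → γs i < γs j → i Fin.< j
      StrictlyIncreasing-reflects-< γs↑ {i} {j} γi<γj with <-cmp i j
      ... | tri< i<j _ _ = i<j
      ... | tri≈ _ refl _ = ⊥-elim (irrefl refl γi<γj)
      ... | tri> _ _ j<i = ⊥-elim (asym γi<γj (γs↑ j i j<i))

      Decomposition : ∀ {n} → Carrierᴹ → (Fin n → Γ) → Set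
      Decomposition {n} f γs = Σ (Fin n → Carrierᴹ) λ fs →
        (∀ i → P (fs i)) × (∀ i → v (fs i) ≡ fin (γs i)) × f ≈ᴹ sumᴹ n fs

      decompose : ∀ f n (γs : Fin n → Γ) → StrictlyIncreasing γs →
        (∀ δ → sp f δ ⇔ Image γs δ) → Decomposition f γs
      decompose f ℕ.zero γs _ sp≐ =
        (λ ()) , (λ ()) , (λ ()) , sp-empty⇒≈0 (λ δ s → ¬Fin0 (proj₁ (to (sp≐ δ) s)))
      decompose f (ℕ.suc ℕ.zero) γs _ sp≐ =
        (λ _ → f) , (λ { zero → Pf }) , (λ { zero → P⇒v Pf }) , ≈ᴹ-sym (+ᴹ-identityʳ f)
        where
        Pf : P f
        Pf = γs zero , λ δ → ⇔-trans (sp≐ δ) (mk⇔ (λ { (zero , refl) → refl }) λ { refl → zero , refl })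
      decompose f (ℕ.suc (ℕ.suc n)) γs γs↑ sp≐ =
        cons (decompose (tail f γ₁) (ℕ.suc n) (λ i → γs (suc i)) (λ i j i<j → γs↑ (suc i) (suc j) (s≤s i<j)) sp-tail≐)
        where
        γ₀ = γs zero
        γ₁ = γs (suc zero)
        γ₀<γ₁ : γ₀ < γ₁
        γ₀<γ₁ = γs↑ zero (suc zero) (s≤s z≤n)

        sp-low⇒γ₀ : ∀ {δ} → sp (tr f γ₁) δ → δ ≡ γ₀
        sp-low⇒γ₀ {δ} s with to (sp-tr f γ₁ δ) s
        ... | sf , δ<γ₁ with to (sp≐ δ) sf
        ... | zero , γ₀≡δ = sym γ₀≡δ
        ... | suc i , refl with StrictlyIncreasing-reflects-< γs↑ δ<γ₁
        ...   | s≤s ()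

        P-low : P (tr f γ₁)
        P-low = γ₀ , λ δ → mk⇔ sp-low⇒γ₀
          λ { refl → from (sp-tr f γ₁ γ₀) (from (sp≐ γ₀) (zero , refl) , γ₀<γ₁) }

        sp-tail≐ : ∀ δ → sp (tail f γ₁) δ ⇔ Image (λ i → γs (suc i)) δ
        sp-tail≐ δ = mk⇔ sp⇒Image Image⇒sp
          where
          sp⇒Image : sp (tail f γ₁) δ → Image (λ i → γs (suc i)) δ
          sp⇒Image s with to (sp-tail f γ₁ δ) s
          ... | sf , ¬δ<γ₁ with to (sp≐ δ) sf
          ... | zero , refl = ⊥-elim (¬δ<γ₁ γ₀<γ₁)
          ... | suc j , γⱼ≡δ = j , γⱼ≡δ
          Image⇒sp : Image (λ i → γs (suc i)) δ → sp (tail f γ₁) δ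
          Image⇒sp (j , refl) = from (sp-tail f γ₁ δ) (from (sp≐ δ) (suc j , refl) ,
            λ γⱼ<γ₁ → case StrictlyIncreasing-reflects-< γs↑ γⱼ<γ₁ of λ { (s≤s ()) })

        cons : Decomposition (tail f γ₁) (λ i → γs (suc i)) → Decomposition f γs
        cons (fs , Ps , vs , tail≈Σ) = tr f γ₁ ∷ fs
          , (λ { zero → P-low ; (suc i) → Ps i })
          , (λ { zero → P⇒v P-low ; (suc i) → vs i })
          , ≈ᴹ-trans (≈ᴹ-sym (tr+tail f γ₁)) (+ᴹ-congˡ tail≈Σ)

      sp⊆Image⇒InSumP : ∀ n (e : Fin n → Γ) f → sp f ⊆ Image e → InSumP f
      sp⊆Image⇒InSumP ℕ.zero e f sp⊆e =
        0 , (λ ()) , (λ ()) , sp-empty⇒≈0 (λ δ s → ¬Fin0 (proj₁ (sp⊆e s)))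
      sp⊆Image⇒InSumP (ℕ.suc n) e f sp⊆e = InSumP-resp split
        (P∪0-+-InSumP (sp⊆｛｝⇒P∪0 sp-top⊆γ) (sp⊆Image⇒InSumP n (λ j → e (punchIn k j)) (tr f γ) sp-low⊆))
        where
        k = proj₁ (max-index <-sto e)
        γ = e k

        split : tail f γ +ᴹ tr f γ ≈ᴹ f
        split = ≈ᴹ-trans (+ᴹ-comm (tail f γ) (tr f γ)) (tr+tail f γ)

        sp-top⊆γ : sp (tail f γ) ⊆ ｛ γ ｝
        sp-top⊆γ {δ} s with to (sp-tail f γ δ) s
        ... | sf , ¬δ<γ with sp⊆e sf
        ... | i , refl with compare (e i) γ
        ...   | tri< δ<γ _ _    = ⊥-elim (¬δ<γ δ<γ)
        ...   | tri≈ _ δ≡γ _    = sym δ≡γ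
        ...   | tri> _ _ γ<δ    = ⊥-elim (proj₂ (max-index <-sto e) i γ<δ)

        sp-low⊆ : sp (tr f γ) ⊆ Image (λ j → e (punchIn k j))
        sp-low⊆ {δ} s with to (sp-tr f γ δ) s
        ... | sf , δ<γ with sp⊆e sf
        ... | i , refl = punchOut k≢i , cong e (punchIn-punchOut k≢i)
          where
          k≢i : k ≢ i
          k≢i refl = irrefl refl δ<γ

      sp-sumᴹ⊆ : ∀ n (fs : Fin n → Carrierᴹ) (Ps : ∀ i → P (fs i)) → sp (sumᴹ n fs) ⊆ Image (λ i → proj₁ (Ps i))
      sp-sumᴹ⊆ ℕ.zero    fs Ps s = ⊥-elim (¬sp-≈0 ≈ᴹ-refl s)
      sp-sumᴹ⊆ (ℕ.suc n) fs Ps s with sp-+ (fs zero) (sumᴹ n (λ i → fs (suc i))) s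
      ... | inj₁ s₀ = zero , sym (to (proj₂ (Ps zero) _) s₀)
      ... | inj₂ s₊ with sp-sumᴹ⊆ n (λ i → fs (suc i)) (λ i → Ps (suc i)) s₊
      ...   | i , γᵢ≡α = suc i , γᵢ≡α

      finite⇔InSumP : ∀ f → V.IsFinite v tr (sp f) ⇔ InSumP f
      finite⇔InSumP f = mk⇔
        (λ (n , e , sp≐e) → sp⊆Image⇒InSumP n e f (λ s → to (sp≐e _) s))
        (λ (n , fs , Ps , f≈Σ) → decidable⊆Image⇒Enumerable (sp? f) (λ i → proj₁ (Ps i))
           (λ s → sp-sumᴹ⊆ n fs Ps (to (sp-cong f≈Σ) s)))

      P∪0-+ : ∀ f g → P∪0 f → P∪0 g → v f ≡ v g → P∪0 (f +ᴹ g)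
      P∪0-+ f g (inj₂ f≈0) g∈P∪0 _ = P∪0-resp (≈ᴹ-sym (≈ᴹ-trans (+ᴹ-congʳ f≈0) (+ᴹ-identityˡ g))) g∈P∪0
      P∪0-+ f g (inj₁ Pf) (inj₂ g≈0) _ = P∪0-resp (≈ᴹ-sym (≈ᴹ-trans (+ᴹ-congˡ g≈0) (+ᴹ-identityʳ f))) (inj₁ Pf)
      P∪0-+ f g (inj₁ Pf) (inj₁ Pg) vf≡vg =
        sp⊆｛｝⇒P∪0 λ s → [ P⇒sp⊆ Pf (P⇒v Pf) , P⇒sp⊆ Pg (trans (sym vf≡vg) (P⇒v Pf)) ]′ (sp-+ f g s)

      Hahn⇒P-proportional : V.IsHahn v → ∀ f g → P f → P g → v f ≡ v g →
        ∃ λ c → ¬ (c ≈ 0#) × f ≈ᴹ c *ₗ g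
      Hahn⇒P-proportional hahn f g Pf Pg vf≡vg with hahn f g (P⇒≉0 Pf) (P⇒≉0 Pg) vf≡vg
      ... | c , c≉0 , f∼cg = c , c≉0 , x∙y⁻¹≈ε⇒x≈y f (c *ₗ g) f-cg≈0
        where
        γ = proj₁ Pf

        sp-f-cg⊆γ : sp (f -ᴹ (c *ₗ g)) ⊆ ｛ γ ｝
        sp-f-cg⊆γ s = [ P⇒sp⊆ Pf (P⇒v Pf) , sp-g⊆γ ∘ to (sp-*ₗ c≉0) ∘ to sp-neg ]′ (sp-+ f (-ᴹ (c *ₗ g)) s)
          where
          sp-g⊆γ : sp g ⊆ ｛ γ ｝
          sp-g⊆γ = P⇒sp⊆ Pg (trans (sym vf≡vg) (P⇒v Pf))

        f-cg≈0 : f -ᴹ (c *ₗ g) ≈ᴹ 0ᴹ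
        f-cg≈0 with v-fin-or-≈0 (f -ᴹ (c *ₗ g))
        ... | inj₂ f-cg≈0    = f-cg≈0
        ... | inj₁ (δ , v≡δ) = ⊥-elim (<∞-irrefl (subst₂ _<∞_ (P⇒v Pf) v≡γ f∼cg))
          where
          v≡γ : v (f -ᴹ (c *ₗ g)) ≡ fin γ
          v≡γ = trans v≡δ (cong fin (sym (sp-f-cg⊆γ (v⇒sp v≡δ))))

lemma2p3 : ExcludedMiddle 0ℓ →
    (C : CommutativeRing 0ℓ 0ℓ) → IsField C →
    (E : Module C 0ℓ 0ℓ) →
    (Γ : Set) (_<_ : Rel Γ 0ℓ) → IsStrictTotalOrder _≡_ _<_ →
    (v : Module.Carrierᴹ E → Γ∞ Γ) → Valued.IsValuation C E Γ _<_ v →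
    (tr : Module.Carrierᴹ E → Γ → Module.Carrierᴹ E) →
    Valued.IsTruncation C E Γ _<_ v tr →
    Valued.Conclusion C E Γ _<_ v tr
lemma2p3 _ C C-field E Γ _<_ <-sto v valuation tr truncation =
  decompose , finite⇔InSumP , P∪0-+ , Hahn⇒P-proportional
  where
  open Valuations C E <-sto
  open Valuation (IsField.1≉0 C-field) valuation
  open Truncation truncation
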